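{- For all integers $n\ge 0$ and $k\ge 1$, $$p^k_n=\sum_{s=0}^{n}\binom{n}{s}\,p^0_s\,k^{n-s}.$$
   Context: A preferential arrangement of a finite set $S$ is an ordered set partition of $S$ (a sequence of nonempty pairwise disjoint blocks with union $S$); the empty set has exactly one. Let $a(w)$ be the number of preferential arrangements of a $w$-element set ($a(0)=1$). A barred preferential arrangement of $X_n=\{1,\dots,n\}$ with $k$ bars is a sequence of $k+1$ possibly empty, pairwise disjoint sections with union $X_n$, each equipped with a preferential arrangement of its elements. A restricted section is one whose preferential arrangement has at most one block; a free section may carry any preferential arrangement. For $k\ge0$, $p^k_n$ is the number of barred preferential arrangements of $X_n$ with $k$ bars in which one fixed section is free and the other $k$ sections are restricted; equivalently $p^k_n=\sum_{w_1+\cdots+w_{k+1}=n}\frac{n!}{w_1!\cdots w_{k+1}!}a(w_{1})$ (sum over nonnegative integer solutions). In particular $p^0_n=a(n)$. -}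

module Defs where

open import Data.Nat using (ℕ; zero; suc; _+_; _*_; _∸_; _≟_; NonZero)
open import Data.Nat.Properties using (_!≢0; m*n≢0)
open import Data.Nat.Base using (_!; _/_)
open import Data.Fin using (Fin)
import Data.Fin.Properties as FinP
open import Data.Vec using (Vec; []; _∷_; head)
open import Data.List using (List; []; _∷_; map; concatMap; length; filter; upTo; allFin)
open import Data.Nat.ListAction using (sum)
open import Data.List.Relation.Unary.All using (All)
open import Data.List.Relation.Unary.All.Properties using ()
import Data.List.Relation.Unary.All as All
import Data.Vec.Membership.DecPropositional as VMem
open import Relation.Nullary.Decidable using (does)
open import Relation.Unary using (Decidable)

-- all functions Fin w → Fin m, represented as vectors of length w
allVecs : (m w : ℕ) → List (Vec (Fin m) w)
allVecs m zero = [] ∷ []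
allVecs m (suc w) = concatMap (λ i → map (i ∷_) (allVecs m w)) (allFin m)

IsSurjective : ∀ {m w} → Vec (Fin m) w → Set
IsSurjective {m} v = All (λ j → VMem._∈_ FinP._≟_ j v) (allFin m)

isSurjective? : ∀ {m w} → Decidable (IsSurjective {m} {w})
isSurjective? {m} v = All.all? (λ j → VMem._∈?_ FinP._≟_ j v) (allFin m)

-- number of ordered set partitions of a w-element set into exactly m blocks
-- (= surjections Fin w → Fin m, block i being the preimage of i)
orderedPartitions : (m w : ℕ) → ℕ
orderedPartitions m w = length (filter isSurjective? (allVecs m w))

-- a(w): number of preferential arrangements (ordered set partitions) of a w-set;
-- a partition of a w-set has at most w blocks
a : ℕ → ℕ
a w = sum (map (λ m → orderedPartitions m w) (upTo (suc w)))

compositions : (j n : ℕ) → List (Vec ℕ j)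
compositions zero zero = [] ∷ []
compositions zero (suc n) = []
compositions (suc j) n =
  concatMap (λ w → map (w ∷_) (compositions j (n ∸ w))) (upTo (suc n))

factProd : ∀ {j} → Vec ℕ j → ℕ
factProd [] = 1
factProd (w ∷ ws) = w ! * factProd ws

factProd≢0 : ∀ {j} (ws : Vec ℕ j) → NonZero (factProd ws)
factProd≢0 [] = _
factProd≢0 (w ∷ ws) = m*n≢0 (w !) (factProd ws) {{w !≢0}} {{factProd≢0 ws}}

multinomial : ∀ {j} → ℕ → Vec ℕ j → ℕ
multinomial n ws = (n ! / factProd ws) {{factProd≢0 ws}}

p : (k n : ℕ) → ℕ
p k n = sum (map (λ ws → multinomial n ws * a (head ws)) (compositions (suc k) n))

-- Split an arrangement after its free section, of size w: the other n − w elements are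
-- spread over k restricted sections in k^(n−w) ways (the multinomial theorem at all
-- ones, by induction on k from the binomial theorem).  Hence p^k_n = Σ_w C(n,w) a(w) k^(n−w)
-- for every k; at k = 0 only w = n survives, so p^0_n = a(n).

module Submission where

open import Defs
open import Data.Nat using (ℕ; suc; _*_; _∸_; _^_; _≤_)
open import Data.Nat.Combinatorics using (_C_)
open import Data.List using (map; upTo)
open import Data.Nat.ListAction using (sum)
open import Relation.Binary.PropositionalEquality using (_≡_)

open import Data.Nat using (zero; _+_; _<_; s≤s⁻¹; s<s⁻¹; _!; _/_)
open import Data.Nat.Properties
open import Data.Nat.Divisibility using (_∣_; ∣-refl; ∣-trans; *-monoʳ-∣)
open import Data.Nat.DivMod using (m*n/n≡m; m/n*n≡m)
open import Data.Nat.Combinatorics using (nCn≡1; k![n∸k]!∣n!)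
open import Data.Nat.Combinatorics.Specification using (nCk≡n!/k![n-k]!)
open import Data.Nat.ListAction.Properties using (sum-++)
open import Data.Nat.Solver using (module +-*-Solver)
open import Data.Fin using (toℕ; fromℕ; inject₁)
open import Data.Fin.Properties using (toℕ<n; toℕ≤pred[n]; toℕ-fromℕ; toℕ-inject₁)
open import Data.List using (List; []; _∷_; _++_; applyUpTo; concatMap)
open import Data.List.Properties using (map-++; map-∘; map-cong; map-cong-local; map-upTo)
open import Data.List.Relation.Unary.All as All using (All; []; _∷_)
open import Data.List.Relation.Unary.All.Properties using (concat⁺; map⁺; applyUpTo⁺₁)
open import Data.Vec using (Vec; []; _∷_; head)
import Data.Vec as Vec
open import Function using (_∘_)
open import Relation.Binary.PropositionalEquality using (refl; sym; trans; cong; cong₂; subst; module ≡-Reasoning)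
open import Algebra.Properties.Monoid.Sum +-0-monoid using (sum-syntax; sum⁺-syntax; sum-cong-≗; sum-init-last; sum-replicate-zero)
import Algebra.Properties.CommutativeSemiring.Binomial +-*-commutativeSemiring as Binomial
import Algebra.Properties.Semiring.Mult +-*-semiring as Mult
import Algebra.Properties.Semiring.Exp +-*-semiring as Exp
open import Algebra.Properties.CommutativeSemigroup *-commutativeSemigroup using (xy∙z≈xz∙y)

open ≡-Reasoning

sum-applyUpTo : ∀ n (f : ℕ → ℕ) → sum (applyUpTo f n) ≡ ∑[ i < n ] f (toℕ i)
sum-applyUpTo zero    f = refl
sum-applyUpTo (suc n) f = cong (f 0 +_) (sum-applyUpTo n (f ∘ suc))

sum-upTo : ∀ n (f : ℕ → ℕ) → sum (map f (upTo n)) ≡ ∑[ i < n ] f (toℕ i)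
sum-upTo n f = trans (cong sum (map-upTo f n)) (sum-applyUpTo n f)

sum-concatMap : ∀ {A B : Set} (h : B → ℕ) (g : A → List B) xs →
  sum (map h (concatMap g xs)) ≡ sum (map (λ x → sum (map h (g x))) xs)
sum-concatMap h g []       = refl
sum-concatMap h g (x ∷ xs) = begin
  sum (map h (g x ++ concatMap g xs))           ≡⟨ cong sum (map-++ h (g x) _) ⟩
  sum (map h (g x) ++ map h (concatMap g xs))   ≡⟨ sum-++ (map h (g x)) _ ⟩
  sum (map h (g x)) + sum (map h (concatMap g xs)) ≡⟨ cong (sum (map h (g x)) +_) (sum-concatMap h g xs) ⟩
  sum (map h (g x)) + sum (map (λ x → sum (map h (g x))) xs) ∎

sum-map-*ˡ : ∀ {A : Set} c (f : A → ℕ) xs → sum (map (λ x → c * f x) xs) ≡ c * sum (map f xs)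
sum-map-*ˡ c f []       = sym (*-zeroʳ c)
sum-map-*ˡ c f (x ∷ xs) = trans (cong (c * f x +_) (sum-map-*ˡ c f xs)) (sym (*-distribˡ-+ c (f x) _))

×≡* : ∀ m n → m Mult.× n ≡ m * n
×≡* zero    n = refl
×≡* (suc m) n = cong (n +_) (×≡* m n)

^-semiring≡^ : ∀ m n → m Exp.^ n ≡ m ^ n
^-semiring≡^ m zero    = refl
^-semiring≡^ m (suc n) = cong (m *_) (^-semiring≡^ m n)

binomial-theorem : ∀ j m → ∑[ w ≤ m ] ((m C toℕ w) * j ^ (m ∸ toℕ w)) ≡ suc j ^ m
binomial-theorem j m = begin
  ∑[ w ≤ m ] ((m C toℕ w) * j ^ (m ∸ toℕ w))
    ≡⟨ sum-cong-≗ term ⟨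
  Binomial.binomialExpansion 1 j m
    ≡⟨ Binomial.theorem m 1 j ⟨
  suc j Exp.^ m
    ≡⟨ ^-semiring≡^ (suc j) m ⟩
  suc j ^ m ∎
  where
  term : ∀ w → Binomial.binomialTerm 1 j m w ≡ (m C toℕ w) * j ^ (m ∸ toℕ w)
  term w = begin
    (m C toℕ w) Mult.× (1 Exp.^ toℕ w * j Exp.^ (m ∸ toℕ w))
      ≡⟨ ×≡* (m C toℕ w) _ ⟩
    (m C toℕ w) * (1 Exp.^ toℕ w * j Exp.^ (m ∸ toℕ w))
      ≡⟨ cong₂ (λ x y → (m C toℕ w) * (x * y)) (trans (^-semiring≡^ 1 (toℕ w)) (^-zeroˡ (toℕ w))) (^-semiring≡^ j (m ∸ toℕ w)) ⟩
    (m C toℕ w) * (1 * j ^ (m ∸ toℕ w))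
      ≡⟨ cong ((m C toℕ w) *_) (*-identityˡ _) ⟩
    (m C toℕ w) * j ^ (m ∸ toℕ w) ∎

m!n!∣[m+n]! : ∀ m n → m ! * n ! ∣ (m + n) !
m!n!∣[m+n]! m n = subst (λ x → m ! * x ! ∣ (m + n) !) (m+n∸m≡n m n) (k![n∸k]!∣n! (m≤m+n m n))

nCk*[k!*[n∸k]!]≡n! : ∀ {n k} → k ≤ n → (n C k) * (k ! * (n ∸ k) !) ≡ n !
nCk*[k!*[n∸k]!]≡n! {n} {k} k≤n = trans (cong (_* (k ! * (n ∸ k) !)) (nCk≡n!/k![n-k]! k≤n))
  (m/n*n≡m {{m*n≢0 (k !) ((n ∸ k) !) {{k !≢0}} {{(n ∸ k) !≢0}}}} (k![n∸k]!∣n! k≤n))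

factProd∣sum! : ∀ {j} (ws : Vec ℕ j) → factProd ws ∣ Vec.sum ws !
factProd∣sum! []       = ∣-refl
factProd∣sum! (w ∷ ws) = ∣-trans (*-monoʳ-∣ (w !) (factProd∣sum! ws)) (m!n!∣[m+n]! w (Vec.sum ws))

multinomial*factProd : ∀ {j} (ws : Vec ℕ j) → multinomial (Vec.sum ws) ws * factProd ws ≡ Vec.sum ws !
multinomial*factProd ws = m/n*n≡m {{factProd≢0 ws}} (factProd∣sum! ws)

multinomial-∷ : ∀ {j n} w (ws : Vec ℕ j) → Vec.sum (w ∷ ws) ≡ n →
  multinomial n (w ∷ ws) ≡ (n C w) * multinomial (n ∸ w) ws
multinomial-∷ w ws refl = begin
  ((w + s) ! / (w ! * factProd ws)) {{factProd≢0 (w ∷ ws)}}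
    ≡⟨ cong (λ x → (x / (w ! * factProd ws)) {{factProd≢0 (w ∷ ws)}}) (sym factored) ⟩
  (c * m * (w ! * factProd ws) / (w ! * factProd ws)) {{factProd≢0 (w ∷ ws)}}
    ≡⟨ m*n/n≡m (c * m) _ {{factProd≢0 (w ∷ ws)}} ⟩
  c * m
    ≡⟨ cong (λ x → c * multinomial x ws) (m+n∸m≡n w s) ⟨
  c * multinomial (w + s ∸ w) ws ∎
  where
  open +-*-Solver
  s = Vec.sum ws
  c = (w + s) C w
  m = multinomial s ws
  factored : c * m * (w ! * factProd ws) ≡ (w + s) !
  factored = begin
    c * m * (w ! * factProd ws)
      ≡⟨ solve 4 (λ c m a f → c :* m :* (a :* f) := c :* (a :* (m :* f))) refl c m (w !) (factProd ws) ⟩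
    c * (w ! * (m * factProd ws))
      ≡⟨ cong (λ x → c * (w ! * x)) (multinomial*factProd ws) ⟩
    c * (w ! * s !)
      ≡⟨ cong (λ x → c * (w ! * x !)) (m+n∸m≡n w s) ⟨
    c * (w ! * (w + s ∸ w) !)
      ≡⟨ nCk*[k!*[n∸k]!]≡n! (m≤m+n w s) ⟩
    (w + s) ! ∎

compositions-sum : ∀ j n → All (λ ws → Vec.sum ws ≡ n) (compositions j n)
compositions-sum zero    zero    = refl ∷ []
compositions-sum zero    (suc n) = []
compositions-sum (suc j) n = concat⁺ (map⁺ (applyUpTo⁺₁ _ (suc n) prepend))
  where
  prepend : ∀ {w} → w < suc n → All (λ ws → Vec.sum ws ≡ n) (map (w ∷_) (compositions j (n ∸ w)))
  prepend {w} w<1+n = map⁺ (All.map (λ s≡n∸w → trans (cong (w +_) s≡n∸w) (m+[n∸m]≡n (s≤s⁻¹ w<1+n)))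
                                    (compositions-sum j (n ∸ w)))

multinomialSum : ℕ → ℕ → ℕ
multinomialSum j n = sum (map (multinomial n) (compositions j n))

sum-compositions-suc : ∀ j n (f : ℕ → ℕ) →
  sum (map (λ ws → multinomial n ws * f (head ws)) (compositions (suc j) n))
    ≡ ∑[ w ≤ n ] ((n C toℕ w) * f (toℕ w) * multinomialSum j (n ∸ toℕ w))
sum-compositions-suc j n f = begin
  sum (map h (concatMap block (upTo (suc n))))
    ≡⟨ sum-concatMap h block (upTo (suc n)) ⟩
  sum (map (λ w → sum (map h (block w))) (upTo (suc n)))
    ≡⟨ sum-upTo (suc n) _ ⟩
  ∑[ w ≤ n ] sum (map h (block (toℕ w)))
    ≡⟨ sum-cong-≗ (λ w → sum-block (toℕ≤pred[n] w)) ⟩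
  ∑[ w ≤ n ] ((n C toℕ w) * f (toℕ w) * multinomialSum j (n ∸ toℕ w)) ∎
  where
  h : Vec ℕ (suc j) → ℕ
  h ws = multinomial n ws * f (head ws)
  block : ℕ → List (Vec ℕ (suc j))
  block w = map (w ∷_) (compositions j (n ∸ w))
  sum-block : ∀ {w} → w ≤ n → sum (map h (block w)) ≡ (n C w) * f w * multinomialSum j (n ∸ w)
  sum-block {w} w≤n = begin
    sum (map h (block w))
      ≡⟨ cong sum (map-∘ tails) ⟨
    sum (map (λ ws → multinomial n (w ∷ ws) * f w) tails)
      ≡⟨ cong sum (map-cong-local (All.map (λ {ws} → split {ws}) (compositions-sum j (n ∸ w)))) ⟩
    sum (map (λ ws → (n C w) * f w * multinomial (n ∸ w) ws) tails)
      ≡⟨ sum-map-*ˡ ((n C w) * f w) (multinomial (n ∸ w)) tails ⟩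
    (n C w) * f w * multinomialSum j (n ∸ w) ∎
    where
    tails : List (Vec ℕ j)
    tails = compositions j (n ∸ w)
    split : ∀ {ws} → Vec.sum ws ≡ n ∸ w → multinomial n (w ∷ ws) * f w ≡ (n C w) * f w * multinomial (n ∸ w) ws
    split {ws} s≡n∸w = begin
      multinomial n (w ∷ ws) * f w
        ≡⟨ cong (_* f w) (multinomial-∷ w ws (trans (cong (w +_) s≡n∸w) (m+[n∸m]≡n w≤n))) ⟩
      (n C w) * multinomial (n ∸ w) ws * f w
        ≡⟨ xy∙z≈xz∙y (n C w) (multinomial (n ∸ w) ws) (f w) ⟩
      (n C w) * f w * multinomial (n ∸ w) ws ∎

multinomialSum≡^ : ∀ j n → multinomialSum j n ≡ j ^ n
multinomialSum≡^ zero    zero    = refl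
multinomialSum≡^ zero    (suc n) = refl
multinomialSum≡^ (suc j) n = begin
  sum (map (multinomial n) (compositions (suc j) n))
    ≡⟨ cong sum (map-cong (λ ws → *-identityʳ (multinomial n ws)) (compositions (suc j) n)) ⟨
  sum (map (λ ws → multinomial n ws * 1) (compositions (suc j) n))
    ≡⟨ sum-compositions-suc j n (λ _ → 1) ⟩
  ∑[ w ≤ n ] ((n C toℕ w) * 1 * multinomialSum j (n ∸ toℕ w))
    ≡⟨ sum-cong-≗ {suc n} (λ w → cong₂ _*_ (*-identityʳ (n C toℕ w)) (multinomialSum≡^ j (n ∸ toℕ w))) ⟩
  ∑[ w ≤ n ] ((n C toℕ w) * j ^ (n ∸ toℕ w))
    ≡⟨ binomial-theorem j n ⟩
  suc j ^ n ∎

p≡∑C*a*^ : ∀ k n → p k n ≡ ∑[ w ≤ n ] ((n C toℕ w) * a (toℕ w) * k ^ (n ∸ toℕ w))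
p≡∑C*a*^ k n = trans (sum-compositions-suc k n a)
  (sum-cong-≗ {suc n} (λ w → cong ((n C toℕ w) * a (toℕ w) *_) (multinomialSum≡^ k (n ∸ toℕ w))))

0^[n∸w]≡0 : ∀ {n w} → w < n → 0 ^ (n ∸ w) ≡ 0
0^[n∸w]≡0 {suc n} {zero}  _   = refl
0^[n∸w]≡0 {suc n} {suc w} w<n = 0^[n∸w]≡0 (s<s⁻¹ w<n)

∑C*f*0^≡f : ∀ n (f : ℕ → ℕ) → ∑[ w ≤ n ] ((n C toℕ w) * f (toℕ w) * 0 ^ (n ∸ toℕ w)) ≡ f n
∑C*f*0^≡f n f = begin
  ∑[ w ≤ n ] term (toℕ w)
    ≡⟨ sum-init-last {n} (term ∘ toℕ) ⟩
  ∑[ w < n ] term (toℕ (inject₁ w)) + term (toℕ (fromℕ n))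
    ≡⟨ cong₂ _+_ (trans (sum-cong-≗ {n} vanish) (sum-replicate-zero n)) (cong term (toℕ-fromℕ n)) ⟩
  term n
    ≡⟨ cong₂ (λ c e → c * f n * 0 ^ e) (nCn≡1 n) (n∸n≡0 n) ⟩
  1 * f n * 1
    ≡⟨ trans (*-identityʳ _) (*-identityˡ _) ⟩
  f n ∎
  where
  term : ℕ → ℕ
  term w = (n C w) * f w * 0 ^ (n ∸ w)
  vanish : ∀ w → term (toℕ (inject₁ w)) ≡ 0
  vanish w = begin
    term (toℕ (inject₁ w))     ≡⟨ cong term (toℕ-inject₁ w) ⟩
    term (toℕ w)               ≡⟨ cong ((n C toℕ w) * f (toℕ w) *_) (0^[n∸w]≡0 (toℕ<n w)) ⟩
    (n C toℕ w) * f (toℕ w) * 0 ≡⟨ *-zeroʳ ((n C toℕ w) * f (toℕ w)) ⟩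
    0 ∎

p0≡a : ∀ n → p 0 n ≡ a n
p0≡a n = trans (p≡∑C*a*^ 0 n) (∑C*f*0^≡f n a)

theorem4 : ∀ (n k : ℕ) → 1 ≤ k →
    p k n ≡ sum (map (λ s → (n C s) * p 0 s * k ^ (n ∸ s)) (upTo (suc n)))
theorem4 n k _ = begin
  p k n
    ≡⟨ p≡∑C*a*^ k n ⟩
  ∑[ s ≤ n ] ((n C toℕ s) * a (toℕ s) * k ^ (n ∸ toℕ s))
    ≡⟨ sum-cong-≗ {suc n} (λ s → cong (λ x → (n C toℕ s) * x * k ^ (n ∸ toℕ s)) (p0≡a (toℕ s))) ⟨
  ∑[ s ≤ n ] ((n C toℕ s) * p 0 (toℕ s) * k ^ (n ∸ toℕ s))
    ≡⟨ sum-upTo (suc n) _ ⟨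
  sum (map (λ s → (n C s) * p 0 s * k ^ (n ∸ s)) (upTo (suc n))) ∎
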